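{- Let $t\ge 5$. If $G$ is a 2-connected co-$(P_3\cup 2K_1)$-induced-minor-free graph and $M$ is a compact $K_t$ minor of $G$, then $G-V(M)$ is $(K_2\cup K_1)$-free, where $V(M)$ denotes the union of the bags of $M$.
   Context: Graphs are finite and simple. A graph is 2-connected if it is connected, has at least three vertices, and stays connected after deleting any single vertex. co-$(P_3\cup 2K_1)$ is $K_5$ with two edges sharing a common endpoint removed; induced-minor-free means no graph isomorphic to it arises by vertex deletions and edge contractions. A $K_t$ minor is given by $t$ pairwise disjoint nonempty vertex sets (bags), each inducing a connected subgraph, with an edge between every two bags; it is compact if every bag has at most two vertices. $(K_2\cup K_1)$-free means no induced subgraph isomorphic to an edge plus an isolated vertex. -}

module Defs where

open import Data.Nat using (ℕ; suc; _≤_)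
open import Data.Fin using (Fin; zero; suc)
open import Data.Maybe using (Maybe; just; nothing)
open import Data.Product using (Σ; ∃; _×_; _,_)
open import Data.Sum using (_⊎_)
open import Data.Empty using (⊥)
open import Data.Unit using (⊤)
open import Relation.Nullary using (¬_)
open import Relation.Binary.PropositionalEquality using (_≡_; _≢_; refl; sym)

record Graph : Set₁ where
  field
    size    : ℕ
    Adj     : Fin size → Fin size → Set
    symAdj  : ∀ {u v} → Adj u v → Adj v u
    irrAdj  : ∀ {u} → ¬ Adj u u
open Graph public

module _ (G : Graph) where

  data WalkIn (S : Fin (size G) → Set) : Fin (size G) → Fin (size G) → Set where
    here : ∀ {u} → S u → WalkIn S u u
    step : ∀ {u w v} → S u → Adj G u w → WalkIn S w v → WalkIn S u v

  -- the induced subgraph G[S] is connected (any two vertices of S are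
  -- joined by a walk inside S); nonemptiness is imposed separately
  ConnectedOn : (Fin (size G) → Set) → Set
  ConnectedOn S = ∀ u v → S u → S v → WalkIn S u v

  Connected : Set
  Connected = (1 ≤ size G) × ConnectedOn (λ _ → ⊤)

  TwoConnected : Set
  TwoConnected = (3 ≤ size G) × Connected × (∀ x → ConnectedOn (λ v → v ≢ x))

-- Minor models.  A map φ : V(G) → Maybe V(H) describes pairwise disjoint
-- bags  B_h = { v | φ v ≡ just h }  (vertices with φ v ≡ nothing are
-- deleted).
module _ (G : Graph) (H : Graph) (φ : Fin (size G) → Maybe (Fin (size H))) where

  Bag : Fin (size H) → Fin (size G) → Set
  Bag h v = φ v ≡ just h

  EdgeBetween : Fin (size H) → Fin (size H) → Set
  EdgeBetween h h' = Σ (Fin (size G)) λ u → Σ (Fin (size G)) λ v →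
    Bag h u × Bag h' v × Adj G u v

  BagsOK : Set
  BagsOK = ∀ h → (∃ λ v → Bag h v) × ConnectedOn G (Bag h)

  IsInducedMinorModel : Set
  IsInducedMinorModel = BagsOK ×
    (∀ h h' → h ≢ h' → (Adj H h h' → EdgeBetween h h') × (EdgeBetween h h' → Adj H h h'))

IsInducedMinor : Graph → Graph → Set
IsInducedMinor H G = Σ (Fin (size G) → Maybe (Fin (size H))) λ φ → IsInducedMinorModel G H φ

-- co-(P3 ∪ 2K1) = K5 on Fin 5 minus the two edges {0,1} and {0,2}
-- (two edges sharing the endpoint 0)
data RemovedEdge : Fin 5 → Fin 5 → Set where
  r01 : RemovedEdge zero (suc zero)
  r10 : RemovedEdge (suc zero) zero
  r02 : RemovedEdge zero (suc (suc zero))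
  r20 : RemovedEdge (suc (suc zero)) zero

coAdj : Fin 5 → Fin 5 → Set
coAdj i j = (i ≢ j) × ¬ RemovedEdge i j

private
  flipR : ∀ {i j} → RemovedEdge i j → RemovedEdge j i
  flipR r01 = r10
  flipR r10 = r01
  flipR r02 = r20
  flipR r20 = r02

coP3∪2K1 : Graph
coP3∪2K1 = record
  { size = 5
  ; Adj = coAdj
  ; symAdj = λ { (ne , nr) → (λ e → ne (sym e)) , (λ r → nr (flipR r)) }
  ; irrAdj = λ { (ne , _) → ne refl }
  }

-- compact K_t minor model in G: φ assigns vertices to bags indexed by Fin t;
-- bags nonempty, connected, pairwise disjoint (built into φ), of size ≤ 2,
-- and every two distinct bags joined by an edge
IsCompactKMinor : (G : Graph) (t : ℕ) → (Fin (size G) → Maybe (Fin t)) → Set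
IsCompactKMinor G t φ =
  (∀ h → (∃ λ v → φ v ≡ just h)
       × ConnectedOn G (λ v → φ v ≡ just h)
       × (∀ a b c → φ a ≡ just h → φ b ≡ just h → φ c ≡ just h →
            (a ≡ b) ⊎ (a ≡ c) ⊎ (b ≡ c)))
  × (∀ h h' → h ≢ h' → Σ (Fin (size G)) λ u → Σ (Fin (size G)) λ v →
       φ u ≡ just h × φ v ≡ just h' × Adj G u v)

K2∪K1-FreeOn : (G : Graph) → (Fin (size G) → Set) → Set
K2∪K1-FreeOn G S = ∀ a b c → S a → S b → S c →
  Adj G a b → c ≢ a → c ≢ b → ¬ Adj G a c → ¬ Adj G b c → ⊥

-- Restrict the K_t model to a compact K_5 model M with bags B_0, …, B_4. The key claim is that
-- every vertex outside M is adjacent to all bags but at most one. A connected set C outside M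
-- that sees two bags and misses two others B_i, B_j yields co-(P3 ∪ 2K1) on C, B_i, B_j and the
-- two seen bags. If C sees at most one bag, enlarge C while this persists; once that is no
-- longer possible, 2-connectivity supplies neighbours of C that, together with bags, again form
-- co-(P3 ∪ 2K1), unless C only reaches a bag {x, z} one of whose vertices sees no other bag:
-- then that vertex is dropped from M, and the argument restarts with a smaller model.
-- Given the claim, for an induced K2 ∪ K1 = {ab, c} outside M two bags B_k, B_l are adjacent
-- to each of a, b, c, and {c}, {a}, {b}, B_k, B_l model co-(P3 ∪ 2K1).

module Submission where

open import Defs
open import Data.Nat as ℕ using (ℕ; _≤_; _<_; _+_)
open import Data.Nat.Properties using (+-monoˡ-<; +-monoʳ-<; _<?_)
open import Data.Nat.Induction using (<-wellFounded)
open import Induction.WellFounded using (Acc; acc)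
open import Data.Fin using (Fin; zero; suc; _≟_; toℕ; fromℕ<; inject≤)
open import Data.Fin.Properties using (any?; all?; toℕ-injective; toℕ-fromℕ<; toℕ-inject≤; toℕ<n; inject≤-injective)
open import Data.Fin.Subset using (Subset; Side; inside; outside; _∈_; _∉_; _⊆_; _⊂_; _∪_; ∁; ⁅_⁆; ∣_∣; Nonempty)
open import Data.Fin.Subset.Properties using (_∈?_; x∈⁅x⁆; x∈⁅y⁆⇒x≡y; x∈p∪q⁺; x∈p∪q⁻; p⊆p∪q; p⊂q⇒∣p∣<∣q∣; p⊂q⇒∁p⊃∁q)
open import Data.Maybe using (Maybe; just; nothing)
open import Data.Maybe.Properties using (just-injective; ≡-dec)
open import Data.Product using (∃; ∃₂; _×_; _,_; proj₁; proj₂)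
open import Data.Sum using (_⊎_; inj₁; inj₂; [_,_]′)
open import Data.Empty using (⊥; ⊥-elim)
open import Data.Unit using (tt)
open import Data.Vec using (tabulate)
open import Data.Vec.Properties using (lookup∘tabulate; []=⇒lookup; lookup⇒[]=)
open import Relation.Nullary using (¬_; Dec; yes; no; ¬?)
open import Relation.Nullary.Decidable using (toWitness; _×-dec_; ¬¬-excluded-middle)
open import Relation.Unary using (Pred; Decidable)
open import Relation.Binary.PropositionalEquality
open import Function using (_∘_)

private
  variable
    n : ℕ

side : ∀ {a} {A : Set a} → Dec A → Side
side (yes _) = inside
side (no _)  = outside

⟦_⟧ : ∀ {ℓ} {P : Pred (Fin n) ℓ} → Decidable P → Subset n
⟦ P? ⟧ = tabulate λ v → side (P? v)

module _ {ℓ} {P : Pred (Fin n) ℓ} (P? : Decidable P) where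

  ∈⟦⟧⁺ : ∀ {v} → P v → v ∈ ⟦ P? ⟧
  ∈⟦⟧⁺ {v} pv = lookup⇒[]= v _ (trans (lookup∘tabulate _ v) (inside-if-yes (P? v)))
    where
    inside-if-yes : (d : Dec (P v)) → side d ≡ inside
    inside-if-yes (yes _) = refl
    inside-if-yes (no ¬pv) = ⊥-elim (¬pv pv)

  ∈⟦⟧⁻ : ∀ {v} → v ∈ ⟦ P? ⟧ → P v
  ∈⟦⟧⁻ {v} v∈ with P? v | trans (sym (lookup∘tabulate (λ u → side (P? u)) v)) ([]=⇒lookup v∈)
  ... | yes pv | _ = pv
  ... | no _   | ()

∣∁-∪⁅⁆∣< : ∀ {p : Subset n} {x} → x ∉ p → ∣ ∁ (p ∪ ⁅ x ⁆) ∣ < ∣ ∁ p ∣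
∣∁-∪⁅⁆∣< {p = p} {x} x∉p = p⊂q⇒∣p∣<∣q∣ (p⊂q⇒∁p⊃∁q (p⊆p∪q ⁅ x ⁆ , x , x∈p∪q⁺ (inj₂ (x∈⁅x⁆ x)) , x∉p))

module VertexSets (G : Graph) where

  Vertex : Set
  Vertex = Fin (size G)

  VertexSet : Set
  VertexSet = Subset (size G)

  Touch : VertexSet → VertexSet → Set
  Touch p q = ∃₂ λ u v → u ∈ p × v ∈ q × Adj G u v

  Disjoint : VertexSet → VertexSet → Set
  Disjoint p q = ∀ {v} → v ∈ p → v ∉ q

  IsConnected : VertexSet → Set
  IsConnected p = ConnectedOn G (_∈ p)

  walk-map : ∀ {S T : Pred Vertex _} → (∀ {v} → S v → T v) → ∀ {u v} → WalkIn G S u v → WalkIn G T u v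
  walk-map f (here s)       = here (f s)
  walk-map f (step s uw wv) = step (f s) uw (walk-map f wv)

  walk-++ : ∀ {S : Pred Vertex _} {u w v} → WalkIn G S u w → WalkIn G S w v → WalkIn G S u v
  walk-++ (here _)       q = q
  walk-++ (step s uw wv) q = step s uw (walk-++ wv q)

  walk-head : ∀ {S : Pred Vertex _} {u v} → WalkIn G S u v → S u
  walk-head (here s)     = s
  walk-head (step s _ _) = s

  walk-exit : ∀ {S : Pred Vertex _} (p : VertexSet) {u v} → WalkIn G S u v → u ∈ p → v ∉ p →
              ∃ λ b → b ∉ p × Touch p ⁅ b ⁆ × S b
  walk-exit p (here _) u∈p v∉p = ⊥-elim (v∉p u∈p)
  walk-exit p (step {u} {w} _ uw wv) u∈p v∉p with w ∈? p
  ... | yes w∈p = walk-exit p wv w∈p v∉p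
  ... | no w∉p  = w , w∉p , (u , w , u∈p , x∈⁅x⁆ w , uw) , walk-head wv

  walk-∪ˡ : ∀ {p q u v} → WalkIn G (_∈ p) u v → WalkIn G (_∈ p ∪ q) u v
  walk-∪ˡ = walk-map λ w∈p → x∈p∪q⁺ (inj₁ w∈p)

  walk-∪ʳ : ∀ {p q u v} → WalkIn G (_∈ q) u v → WalkIn G (_∈ p ∪ q) u v
  walk-∪ʳ = walk-map λ w∈q → x∈p∪q⁺ (inj₂ w∈q)

  touch-sym : ∀ {p q} → Touch p q → Touch q p
  touch-sym (u , v , u∈p , v∈q , uv) = v , u , v∈q , u∈p , symAdj G uv

  ∪-touchˡ : ∀ {p q r} → Touch p r → Touch (p ∪ q) r
  ∪-touchˡ (u , v , u∈p , v∈r , uv) = u , v , x∈p∪q⁺ (inj₁ u∈p) , v∈r , uv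

  ∪-touchʳ : ∀ {p q r} → Touch q r → Touch (p ∪ q) r
  ∪-touchʳ (u , v , u∈q , v∈r , uv) = u , v , x∈p∪q⁺ (inj₂ u∈q) , v∈r , uv

  touch-∪ˡ : ∀ {p q r} → Touch p q → Touch p (q ∪ r)
  touch-∪ˡ = touch-sym ∘ ∪-touchˡ ∘ touch-sym

  touch-∪ʳ : ∀ {p q r} → Touch p r → Touch p (q ∪ r)
  touch-∪ʳ = touch-sym ∘ ∪-touchʳ ∘ touch-sym

  ∪-touch⁻ : ∀ {p q r} → Touch (p ∪ q) r → ¬ Touch p r → Touch q r
  ∪-touch⁻ {p} {q} (u , v , u∈p∪q , v∈r , uv) p≁r with x∈p∪q⁻ p q u∈p∪q
  ... | inj₁ u∈p = ⊥-elim (p≁r (u , v , u∈p , v∈r , uv))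
  ... | inj₂ u∈q = u , v , u∈q , v∈r , uv

  touch-⊆ʳ : ∀ {p q r} → q ⊆ r → Touch p q → Touch p r
  touch-⊆ʳ q⊆r (u , v , u∈p , v∈q , uv) = u , v , u∈p , q⊆r v∈q , uv

  touch-⁅⁆ : ∀ {p q w} → Touch p ⁅ w ⁆ → w ∈ q → Touch p q
  touch-⁅⁆ {w = w} (u , v , u∈p , v∈⁅w⁆ , uv) w∈q rewrite x∈⁅y⁆⇒x≡y w v∈⁅w⁆ = u , w , u∈p , w∈q , uv

  touch-⁅⁆⁅⁆⁻ : ∀ {u v} → Touch ⁅ u ⁆ ⁅ v ⁆ → Adj G u v
  touch-⁅⁆⁅⁆⁻ {u} {v} (a , b , a∈⁅u⁆ , b∈⁅v⁆ , ab) rewrite x∈⁅y⁆⇒x≡y u a∈⁅u⁆ | x∈⁅y⁆⇒x≡y v b∈⁅v⁆ = ab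

  disjoint-sym : ∀ {p q} → Disjoint p q → Disjoint q p
  disjoint-sym p∩q v∈q v∈p = p∩q v∈p v∈q

  disjoint-∪ : ∀ {p q r} → Disjoint p r → Disjoint q r → Disjoint (p ∪ q) r
  disjoint-∪ {p} {q} p∩r q∩r v∈p∪q with x∈p∪q⁻ p q v∈p∪q
  ... | inj₁ v∈p = p∩r v∈p
  ... | inj₂ v∈q = q∩r v∈q

  disjoint-∪ʳ : ∀ {p q r} → Disjoint r p → Disjoint r q → Disjoint r (p ∪ q)
  disjoint-∪ʳ r∩p r∩q v∈r v∈p∪q = disjoint-∪ (disjoint-sym r∩p) (disjoint-sym r∩q) v∈p∪q v∈r

  disjoint-⁅⁆ : ∀ {x q} → x ∉ q → Disjoint ⁅ x ⁆ q
  disjoint-⁅⁆ {x} x∉q v∈⁅x⁆ rewrite x∈⁅y⁆⇒x≡y x v∈⁅x⁆ = x∉q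

  connected-⁅⁆ : ∀ x → IsConnected ⁅ x ⁆
  connected-⁅⁆ x u v u∈ v∈ rewrite x∈⁅y⁆⇒x≡y x u∈ | x∈⁅y⁆⇒x≡y x v∈ = here (x∈⁅x⁆ x)

  connected-∪ : ∀ {p q} → IsConnected p → IsConnected q → Touch p q → IsConnected (p ∪ q)
  connected-∪ {p} {q} conn-p conn-q (a , b , a∈p , b∈q , ab) u v u∈ v∈
    with x∈p∪q⁻ p q u∈ | x∈p∪q⁻ p q v∈
  ... | inj₁ u∈p | inj₁ v∈p = walk-∪ˡ (conn-p u v u∈p v∈p)
  ... | inj₂ u∈q | inj₂ v∈q = walk-∪ʳ (conn-q u v u∈q v∈q)
  ... | inj₁ u∈p | inj₂ v∈q = walk-++ (walk-∪ˡ (conn-p u a u∈p a∈p))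
                                (step (x∈p∪q⁺ (inj₁ a∈p)) ab (walk-∪ʳ (conn-q b v b∈q v∈q)))
  ... | inj₂ u∈q | inj₁ v∈p = walk-++ (walk-∪ʳ (conn-q u b u∈q b∈q))
                                (step (x∈p∪q⁺ (inj₂ b∈q)) (symAdj G ab) (walk-∪ˡ (conn-p a v a∈p v∈p)))

  module _ (H : Graph) (S : Fin (size H) → VertexSet)
           (disjoint : ∀ {i j} → i ≢ j → Disjoint (S i) (S j)) where

    private
      label : Vertex → Maybe (Fin (size H))
      label v with any? (λ i → v ∈? S i)
      ... | yes (i , _) = just i
      ... | no _        = nothing

      label⇒∈ : ∀ {v i} → label v ≡ just i → v ∈ S i
      label⇒∈ {v} v↦i with any? (λ i → v ∈? S i)
      label⇒∈ refl | yes (_ , v∈) = v∈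

      ∈⇒label : ∀ {v i} → v ∈ S i → label v ≡ just i
      ∈⇒label {v} {i} v∈i with any? (λ j → v ∈? S j)
      ... | no v∉⋃ = ⊥-elim (v∉⋃ (i , v∈i))
      ... | yes (j , v∈j) with j ≟ i
      ...   | yes refl = refl
      ...   | no j≢i   = ⊥-elim (disjoint j≢i v∈j v∈i)

    inducedMinor-fromSets : (∀ i → Nonempty (S i)) → (∀ i → IsConnected (S i)) →
                            (∀ {i j} → i ≢ j → Adj H i j → Touch (S i) (S j)) →
                            (∀ {i j} → i ≢ j → Touch (S i) (S j) → Adj H i j) →
                            IsInducedMinor H G
    inducedMinor-fromSets nonempty connected adj⇒touch touch⇒adj = label , bags , edges
      where
      bags : BagsOK G H label
      bags h = (proj₁ (nonempty h) , ∈⇒label (proj₂ (nonempty h)))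
             , λ u v u∈ v∈ → walk-map ∈⇒label (connected h u v (label⇒∈ u∈) (label⇒∈ v∈))
      edges : ∀ h h' → h ≢ h' → (Adj H h h' → EdgeBetween G H label h h') × (EdgeBetween G H label h h' → Adj H h h')
      edges h h' h≢h' = (λ hh' → let (u , v , u∈ , v∈ , uv) = adj⇒touch h≢h' hh' in u , v , ∈⇒label u∈ , ∈⇒label v∈ , uv)
                      , λ (u , v , u↦h , v↦h' , uv) → touch⇒adj h≢h' (u , v , label⇒∈ u↦h , label⇒∈ v↦h' , uv)

pattern i₀ = zero
pattern i₁ = suc i₀
pattern i₂ = suc i₁
pattern i₃ = suc i₂
pattern i₄ = suc i₃

module _ {ℓ} (R : Fin 5 → Fin 5 → Set ℓ) (R-sym : ∀ {i j} → R i j → R j i) where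

  fromPairs : R i₀ i₁ → R i₀ i₂ → R i₀ i₃ → R i₀ i₄ → R i₁ i₂ → R i₁ i₃ → R i₁ i₄ → R i₂ i₃ → R i₂ i₄ → R i₃ i₄ →
              ∀ {i j} → i ≢ j → R i j
  fromPairs r₀₁ r₀₂ r₀₃ r₀₄ r₁₂ r₁₃ r₁₄ r₂₃ r₂₄ r₃₄ = pairs _ _
    where
    pairs : ∀ i j → i ≢ j → R i j
    pairs i₀ i₁ _ = r₀₁
    pairs i₀ i₂ _ = r₀₂
    pairs i₀ i₃ _ = r₀₃
    pairs i₀ i₄ _ = r₀₄
    pairs i₁ i₂ _ = r₁₂
    pairs i₁ i₃ _ = r₁₃
    pairs i₁ i₄ _ = r₁₄
    pairs i₂ i₃ _ = r₂₃
    pairs i₂ i₄ _ = r₂₄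
    pairs i₃ i₄ _ = r₃₄
    pairs i₁ i₀ _ = R-sym r₀₁
    pairs i₂ i₀ _ = R-sym r₀₂
    pairs i₃ i₀ _ = R-sym r₀₃
    pairs i₄ i₀ _ = R-sym r₀₄
    pairs i₂ i₁ _ = R-sym r₁₂
    pairs i₃ i₁ _ = R-sym r₁₃
    pairs i₄ i₁ _ = R-sym r₁₄
    pairs i₃ i₂ _ = R-sym r₂₃
    pairs i₄ i₂ _ = R-sym r₂₄
    pairs i₄ i₃ _ = R-sym r₃₄
    pairs i₀ i₀ i≢i = ⊥-elim (i≢i refl)
    pairs i₁ i₁ i≢i = ⊥-elim (i≢i refl)
    pairs i₂ i₂ i≢i = ⊥-elim (i≢i refl)
    pairs i₃ i₃ i≢i = ⊥-elim (i≢i refl)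
    pairs i₄ i₄ i≢i = ⊥-elim (i≢i refl)

removedEdge-sym : ∀ {i j} → RemovedEdge i j → RemovedEdge j i
removedEdge-sym r01 = r10
removedEdge-sym r10 = r01
removedEdge-sym r02 = r20
removedEdge-sym r20 = r02

module CoP3∪2K1Minor (G : Graph) where
  open VertexSets G

  record CoP3∪2K1Sets : Set where
    field
      S         : Fin 5 → VertexSet
      nonempty  : ∀ i → Nonempty (S i)
      connected : ∀ i → IsConnected (S i)
      disjoint₀₁ : Disjoint (S i₀) (S i₁)
      disjoint₀₂ : Disjoint (S i₀) (S i₂)
      disjoint₀₃ : Disjoint (S i₀) (S i₃)
      disjoint₀₄ : Disjoint (S i₀) (S i₄)
      disjoint₁₂ : Disjoint (S i₁) (S i₂)
      disjoint₁₃ : Disjoint (S i₁) (S i₃)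
      disjoint₁₄ : Disjoint (S i₁) (S i₄)
      disjoint₂₃ : Disjoint (S i₂) (S i₃)
      disjoint₂₄ : Disjoint (S i₂) (S i₄)
      disjoint₃₄ : Disjoint (S i₃) (S i₄)
      touch₀₃ : Touch (S i₀) (S i₃)
      touch₀₄ : Touch (S i₀) (S i₄)
      touch₁₂ : Touch (S i₁) (S i₂)
      touch₁₃ : Touch (S i₁) (S i₃)
      touch₁₄ : Touch (S i₁) (S i₄)
      touch₂₃ : Touch (S i₂) (S i₃)
      touch₂₄ : Touch (S i₂) (S i₄)
      touch₃₄ : Touch (S i₃) (S i₄)
      apart₀₁ : ¬ Touch (S i₀) (S i₁)
      apart₀₂ : ¬ Touch (S i₀) (S i₂)

  coP3∪2K1-fromSets : CoP3∪2K1Sets → IsInducedMinor coP3∪2K1 G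
  coP3∪2K1-fromSets sets = inducedMinor-fromSets coP3∪2K1 S disjoint nonempty connected
    (λ i≢j (_ , ¬removed) → touch i≢j ¬removed) (λ i≢j t → i≢j , λ removed → apart removed t)
    where
    open CoP3∪2K1Sets sets
    disjoint : ∀ {i j} → i ≢ j → Disjoint (S i) (S j)
    disjoint = fromPairs (λ i j → Disjoint (S i) (S j)) disjoint-sym
      disjoint₀₁ disjoint₀₂ disjoint₀₃ disjoint₀₄ disjoint₁₂ disjoint₁₃ disjoint₁₄ disjoint₂₃ disjoint₂₄ disjoint₃₄
    touch : ∀ {i j} → i ≢ j → ¬ RemovedEdge i j → Touch (S i) (S j)
    touch = fromPairs (λ i j → ¬ RemovedEdge i j → Touch (S i) (S j))
      (λ t ¬removed → touch-sym (t (λ removed → ¬removed (removedEdge-sym removed))))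
      (λ ¬removed → ⊥-elim (¬removed r01)) (λ ¬removed → ⊥-elim (¬removed r02))
      (λ _ → touch₀₃) (λ _ → touch₀₄) (λ _ → touch₁₂) (λ _ → touch₁₃) (λ _ → touch₁₄)
      (λ _ → touch₂₃) (λ _ → touch₂₄) (λ _ → touch₃₄)
    apart : ∀ {i j} → RemovedEdge i j → ¬ Touch (S i) (S j)
    apart r01 = apart₀₁
    apart r10 = apart₀₁ ∘ touch-sym
    apart r02 = apart₀₂
    apart r20 = apart₀₂ ∘ touch-sym

module CompactMinors (G : Graph) {t : ℕ} where
  open VertexSets G

  Labelling : Set
  Labelling = Vertex → Maybe (Fin t)

  _≟ᴹ_ : (m m' : Maybe (Fin t)) → Dec (m ≡ m')
  _≟ᴹ_ = ≡-dec _≟_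

  bag : Labelling → Fin t → VertexSet
  bag ψ h = ⟦ (λ v → ψ v ≟ᴹ just h) ⟧

  support : Labelling → VertexSet
  support ψ = ⟦ (λ v → ¬? (ψ v ≟ᴹ nothing)) ⟧

  Outside : Labelling → VertexSet → Set
  Outside ψ C = ∀ {v} → v ∈ C → ψ v ≡ nothing

  module _ {ψ : Labelling} where

    ∈bag⁺ : ∀ {v h} → ψ v ≡ just h → v ∈ bag ψ h
    ∈bag⁺ = ∈⟦⟧⁺ (λ v → ψ v ≟ᴹ just _)

    ∈bag⁻ : ∀ {v h} → v ∈ bag ψ h → ψ v ≡ just h
    ∈bag⁻ = ∈⟦⟧⁻ (λ v → ψ v ≟ᴹ just _)

    bags-disjoint : ∀ {h h'} → h ≢ h' → Disjoint (bag ψ h) (bag ψ h')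
    bags-disjoint h≢h' v∈h v∈h' = h≢h' (just-injective (trans (sym (∈bag⁻ v∈h)) (∈bag⁻ v∈h')))

    ≡just⇒≢nothing : ∀ {v h} → ψ v ≡ just h → ψ v ≢ nothing
    ≡just⇒≢nothing ψv≡h ψv≡nothing with trans (sym ψv≡h) ψv≡nothing
    ... | ()

    ∉bag-of-outside : ∀ {w h} → ψ w ≡ nothing → w ∉ bag ψ h
    ∉bag-of-outside ψw≡nothing w∈h = ≡just⇒≢nothing (∈bag⁻ w∈h) ψw≡nothing

    ∉bag-of-other : ∀ {x k h} → ψ x ≡ just k → k ≢ h → x ∉ bag ψ h
    ∉bag-of-other ψx≡k k≢h x∈h = k≢h (just-injective (trans (sym ψx≡k) (∈bag⁻ x∈h)))

    outside-disjoint : ∀ {C h} → Outside ψ C → Disjoint C (bag ψ h)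
    outside-disjoint outC v∈C = ∉bag-of-outside (outC v∈C)

    outside-∉C : ∀ {C x k} → Outside ψ C → ψ x ≡ just k → x ∉ C
    outside-∉C outC ψx≡k x∈C = ≡just⇒≢nothing ψx≡k (outC x∈C)

    module _ (model : IsCompactKMinor G t ψ) where

      bag-nonempty : ∀ h → Nonempty (bag ψ h)
      bag-nonempty h = let (v , v↦h) = proj₁ (proj₁ model h) in v , ∈bag⁺ v↦h

      bag-connected : ∀ h → IsConnected (bag ψ h)
      bag-connected h u v u∈ v∈ = walk-map ∈bag⁺ (proj₁ (proj₂ (proj₁ model h)) u v (∈bag⁻ u∈) (∈bag⁻ v∈))

      bags-touch : ∀ {h h'} → h ≢ h' → Touch (bag ψ h) (bag ψ h')
      bags-touch h≢h' = let (u , v , u↦h , v↦h' , uv) = proj₂ model _ _ h≢h' in u , v , ∈bag⁺ u↦h , ∈bag⁺ v↦h' , uv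

      bag-atMostTwo : ∀ {h a b c} → ψ a ≡ just h → ψ b ≡ just h → ψ c ≡ just h → a ≡ b ⊎ a ≡ c ⊎ b ≡ c
      bag-atMostTwo = proj₂ (proj₂ (proj₁ model _)) _ _ _

  without : Labelling → Vertex → Labelling
  without ψ x v with v ≟ x
  ... | yes _ = nothing
  ... | no _  = ψ v

  module _ {ψ : Labelling} {x : Vertex} where

    without-≢ : ∀ {v} → v ≢ x → without ψ x v ≡ ψ v
    without-≢ {v} v≢x with v ≟ x
    ... | yes v≡x = ⊥-elim (v≢x v≡x)
    ... | no _    = refl

    without-self : without ψ x x ≡ nothing
    without-self with x ≟ x
    ... | yes _   = refl
    ... | no x≢x = ⊥-elim (x≢x refl)

    without-just : ∀ {v h} → without ψ x v ≡ just h → ψ v ≡ just h × v ≢ x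
    without-just {v} v↦h with v ≟ x
    ... | no v≢x = v↦h , v≢x

    bag-without-⊆ : ∀ {h} → bag (without ψ x) h ⊆ bag ψ h
    bag-without-⊆ v∈ = ∈bag⁺ (proj₁ (without-just (∈bag⁻ v∈)))

    support-without-⊂ : ψ x ≢ nothing → support (without ψ x) ⊂ support ψ
    support-without-⊂ ψx≢nothing =
        (λ v∈ → ∈⟦⟧⁺ decide (λ ψv≡nothing → ∈⟦⟧⁻ decide v∈ (without-nothing ψv≡nothing)))
      , x , ∈⟦⟧⁺ decide ψx≢nothing , λ x∈ → ∈⟦⟧⁻ decide x∈ without-self
      where
      decide : ∀ {φ : Labelling} v → Dec (φ v ≢ nothing)
      decide {φ} v = ¬? (φ v ≟ᴹ nothing)
      without-nothing : ∀ {v} → ψ v ≡ nothing → without ψ x v ≡ nothing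
      without-nothing {v} ψv≡nothing with v ≟ x
      ... | yes _ = refl
      ... | no _  = ψv≡nothing

    -- As x sees no other bag, every edge from bag k to another bag leaves from z.
    without-isCompactKMinor : ∀ {k z} → IsCompactKMinor G t ψ → ψ x ≡ just k → ψ z ≡ just k → x ≢ z →
                              (∀ h → h ≢ k → ¬ Touch ⁅ x ⁆ (bag ψ h)) → IsCompactKMinor G t (without ψ x)
    without-isCompactKMinor {k} {z} model ψx≡k ψz≡k x≢z x-private = bags , edges
      where
      ψ' = without ψ x
      x↦ : ∀ {h} → ψ x ≡ just h → h ≡ k
      x↦ ψx≡h = just-injective (trans (sym ψx≡h) ψx≡k)
      other-bag : ∀ {v h} → ψ v ≡ just h → h ≢ k → ψ' v ≡ just h
      other-bag {v} ψv≡h h≢k = trans (without-≢ λ v≡x → h≢k (x↦ (subst (λ u → ψ u ≡ just _) v≡x ψv≡h))) ψv≡h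
      is-z : ∀ {v} → ψ' v ≡ just k → v ≡ z
      is-z v↦k with without-just v↦k
      ... | ψv≡k , v≢x with bag-atMostTwo model ψx≡k ψz≡k ψv≡k
      ...   | inj₁ x≡z        = ⊥-elim (x≢z x≡z)
      ...   | inj₂ (inj₁ x≡v) = ⊥-elim (v≢x (sym x≡v))
      ...   | inj₂ (inj₂ z≡v) = sym z≡v
      at-most-two : ∀ {h} a b c → ψ' a ≡ just h → ψ' b ≡ just h → ψ' c ≡ just h → a ≡ b ⊎ a ≡ c ⊎ b ≡ c
      at-most-two a b c a↦ b↦ c↦ =
        bag-atMostTwo model (proj₁ (without-just a↦)) (proj₁ (without-just b↦)) (proj₁ (without-just c↦))
      bags : ∀ h → (∃ λ v → ψ' v ≡ just h) × ConnectedOn G (λ v → ψ' v ≡ just h)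
                 × (∀ a b c → ψ' a ≡ just h → ψ' b ≡ just h → ψ' c ≡ just h → a ≡ b ⊎ a ≡ c ⊎ b ≡ c)
      bags h with h ≟ k
      ... | yes refl = (z , trans (without-≢ (x≢z ∘ sym)) ψz≡k)
                     , (λ u v u↦k v↦k → subst (WalkIn G _ u) (trans (is-z u↦k) (sym (is-z v↦k))) (here u↦k))
                     , at-most-two
      ... | no h≢k   = (let (v , v↦h) = proj₁ (proj₁ model h) in v , other-bag v↦h h≢k)
                     , (λ u v u↦h v↦h → walk-map (λ w↦h → other-bag w↦h h≢k)
                          (proj₁ (proj₂ (proj₁ model h)) u v (proj₁ (without-just u↦h)) (proj₁ (without-just v↦h))))
                     , at-most-two
      edges : ∀ h h' → h ≢ h' → ∃₂ λ u v → ψ' u ≡ just h × ψ' v ≡ just h' × Adj G u v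
      edges h h' h≢h' with proj₂ model h h' h≢h'
      ... | u , v , u↦h , v↦h' , uv with u ≟ x | v ≟ x
      ...   | yes refl | _ =
        ⊥-elim (x-private h' (λ h'≡k → h≢h' (trans (x↦ u↦h) (sym h'≡k))) (x , v , x∈⁅x⁆ x , ∈bag⁺ v↦h' , uv))
      ...   | no u≢x | yes refl =
        ⊥-elim (x-private h (λ h≡k → h≢h' (trans h≡k (sym (x↦ v↦h')))) (x , u , x∈⁅x⁆ x , ∈bag⁺ u↦h , symAdj G uv))
      ...   | no u≢x | no v≢x = u , v , trans (without-≢ u≢x) u↦h , trans (without-≢ v≢x) v↦h' , uv

¬¬-∀-Fin : ∀ {n} {P : Fin n → Set} → (∀ i → ¬ ¬ P i) → ¬ ¬ (∀ i → P i)
¬¬-∀-Fin {ℕ.zero} ¬¬P ¬∀P = ¬∀P λ ()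
¬¬-∀-Fin {ℕ.suc n} ¬¬P ¬∀P = ¬¬P zero λ P0 → ¬¬-∀-Fin (¬¬P ∘ suc) λ P∘suc → ¬∀P λ { zero → P0 ; (suc i) → P∘suc i }

AllBut : ∀ {n} → Fin n → (Fin n → Set) → Set
AllBut e P = ∀ h → h ≢ e → P h

¬¬-allBut : ∀ {n} {P : Fin (ℕ.suc n) → Set} → (∀ {i j} → i ≢ j → ¬ P i → ¬ P j → ⊥) → ¬ ¬ ∃ λ e → AllBut e P
¬¬-allBut {P = P} fails-once goal = ¬¬-excluded-middle {A = ∃ λ e → ¬ P e} λ
  { (yes (e , ¬Pe)) → ¬¬-∀-Fin (λ h ¬P′ → ¬¬-excluded-middle {A = P h} λ
        { (yes Ph) → ¬P′ λ _ → Ph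
        ; (no ¬Ph) → ¬P′ λ h≢e → ⊥-elim (fails-once h≢e ¬Ph ¬Pe) })
      λ allBut-e → goal (e , allBut-e)
  ; (no ∄¬P) → ¬¬-∀-Fin (λ h ¬Ph → ∄¬P (h , ¬Ph)) λ all → goal (zero , λ h _ → all h) }

-- Abstract so that type checking never unfolds the exhaustive search.
abstract
  two-others : ∀ (p q r : Fin 5) → ∃₂ λ i j → i ≢ j × (i ≢ p × i ≢ q × i ≢ r) × (j ≢ p × j ≢ q × j ≢ r)
  two-others = toWitness {a? = all? λ p → all? λ q → all? λ r → any? λ i → any? λ j →
    ¬? (i ≟ j) ×-dec (¬? (i ≟ p) ×-dec ¬? (i ≟ q) ×-dec ¬? (i ≟ r)) ×-dec (¬? (j ≟ p) ×-dec ¬? (j ≟ q) ×-dec ¬? (j ≟ r))} _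

  three-others : ∀ (p q : Fin 5) → ∃₂ λ i j → ∃ λ m → (i ≢ j × i ≢ m × j ≢ m) × (i ≢ p × i ≢ q) × (j ≢ p × j ≢ q) × (m ≢ p × m ≢ q)
  three-others = toWitness {a? = all? λ p → all? λ q → any? λ i → any? λ j → any? λ m →
    (¬? (i ≟ j) ×-dec ¬? (i ≟ m) ×-dec ¬? (j ≟ m)) ×-dec (¬? (i ≟ p) ×-dec ¬? (i ≟ q)) ×-dec (¬? (j ≟ p) ×-dec ¬? (j ≟ q)) ×-dec (¬? (m ≟ p) ×-dec ¬? (m ≟ q))} _

module SmallPieces (G : Graph) (noMinor : ¬ IsInducedMinor coP3∪2K1 G) where
  open VertexSets G
  open CoP3∪2K1Minor G
  open CompactMinors G {5}

  record OutsidePiece (ψ : Labelling) (C : VertexSet) : Set where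
    field
      lies-outside : Outside ψ C
      connected    : IsConnected C
      nonempty     : Nonempty C

  AtMostOneBag : Labelling → VertexSet → Set
  AtMostOneBag ψ C = ∀ {k l} → k ≢ l → Touch C (bag ψ k) → Touch C (bag ψ l) → ⊥

  OutsideNeighbour : Labelling → VertexSet → Vertex → Set
  OutsideNeighbour ψ C w = ψ w ≡ nothing × w ∉ C × Touch C ⁅ w ⁆

  Saturated : Labelling → VertexSet → Set
  Saturated ψ C = ∀ {w} → OutsideNeighbour ψ C w → ¬ AtMostOneBag ψ (C ∪ ⁅ w ⁆)

  Enclosed : Labelling → VertexSet → Set
  Enclosed ψ C = ∀ {w} → ¬ OutsideNeighbour ψ C w

  record SmallerModel (ψ : Labelling) (C : VertexSet) : Set where
    field
      labelling : Labelling
      model     : IsCompactKMinor G 5 labelling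
      piece     : OutsidePiece labelling C
      atMostOne : AtMostOneBag labelling C
      smaller   : ∣ support labelling ∣ < ∣ support ψ ∣

  extend : ∀ {ψ C w} → OutsidePiece ψ C → OutsideNeighbour ψ C w → OutsidePiece ψ (C ∪ ⁅ w ⁆)
  extend {ψ} {C} {w} piece (ψw≡nothing , _ , C~w) = record
    { lies-outside = λ {v} v∈ → [ lies-outside , (λ v∈⁅w⁆ → subst (λ u → ψ u ≡ nothing) (sym (x∈⁅y⁆⇒x≡y w v∈⁅w⁆)) ψw≡nothing) ]′
                                  (x∈p∪q⁻ C ⁅ w ⁆ v∈)
    ; connected    = connected-∪ connected (connected-⁅⁆ w) C~w
    ; nonempty     = proj₁ nonempty , x∈p∪q⁺ (inj₁ (proj₂ nonempty))
    }
    where open OutsidePiece piece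

  module _ {ψ : Labelling} (model : IsCompactKMinor G 5 ψ) where

    -- C, B_i, B_j, X, Y become the vertices 0, …, 4 of co-(P3 ∪ 2K1); C misses exactly B_i and B_j.
    record BagObstruction (C X Y : VertexSet) (i j : Fin 5) : Set where
      field
        piece      : OutsidePiece ψ C
        i≢j        : i ≢ j
        C-misses-i : ¬ Touch C (bag ψ i)
        C-misses-j : ¬ Touch C (bag ψ j)
        X-nonempty : Nonempty X
        Y-nonempty : Nonempty Y
        X-connected : IsConnected X
        Y-connected : IsConnected Y
        X∩Y : Disjoint X Y
        C∩X : Disjoint C X
        C∩Y : Disjoint C Y
        X∩i : Disjoint X (bag ψ i)
        X∩j : Disjoint X (bag ψ j)
        Y∩i : Disjoint Y (bag ψ i)
        Y∩j : Disjoint Y (bag ψ j)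
        X~Y : Touch X Y
        C~X : Touch C X
        C~Y : Touch C Y
        X~i : Touch X (bag ψ i)
        X~j : Touch X (bag ψ j)
        Y~i : Touch Y (bag ψ i)
        Y~j : Touch Y (bag ψ j)

    bagObstruction⇒⊥ : ∀ {C X Y i j} → BagObstruction C X Y i j → ⊥
    bagObstruction⇒⊥ {C} {X} {Y} {i} {j} obstruction = noMinor (coP3∪2K1-fromSets record
      { S          = S
      ; nonempty   = λ { i₀ → nonempty ; i₁ → bag-nonempty model i ; i₂ → bag-nonempty model j ; i₃ → X-nonempty ; i₄ → Y-nonempty }
      ; connected  = λ { i₀ → connected ; i₁ → bag-connected model i ; i₂ → bag-connected model j ; i₃ → X-connected ; i₄ → Y-connected }
      ; disjoint₀₁ = outside-disjoint lies-outside
      ; disjoint₀₂ = outside-disjoint lies-outside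
      ; disjoint₀₃ = C∩X
      ; disjoint₀₄ = C∩Y
      ; disjoint₁₂ = bags-disjoint i≢j
      ; disjoint₁₃ = disjoint-sym X∩i
      ; disjoint₁₄ = disjoint-sym Y∩i
      ; disjoint₂₃ = disjoint-sym X∩j
      ; disjoint₂₄ = disjoint-sym Y∩j
      ; disjoint₃₄ = X∩Y
      ; touch₀₃ = C~X
      ; touch₀₄ = C~Y
      ; touch₁₂ = bags-touch model i≢j
      ; touch₁₃ = touch-sym X~i
      ; touch₁₄ = touch-sym Y~i
      ; touch₂₃ = touch-sym X~j
      ; touch₂₄ = touch-sym Y~j
      ; touch₃₄ = X~Y
      ; apart₀₁ = C-misses-i
      ; apart₀₂ = C-misses-j
      })
      where
      open BagObstruction obstruction
      open OutsidePiece piece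
      S : Fin 5 → VertexSet
      S i₀ = C
      S i₁ = bag ψ i
      S i₂ = bag ψ j
      S i₃ = X
      S i₄ = Y

    touches-two⇒misses-at-most-one : ∀ {C k l} → OutsidePiece ψ C → k ≢ l → Touch C (bag ψ k) → Touch C (bag ψ l) →
                                      ∀ {i j} → i ≢ j → ¬ Touch C (bag ψ i) → ¬ Touch C (bag ψ j) → ⊥
    touches-two⇒misses-at-most-one {C} {k} {l} piece k≢l C~k C~l {i} {j} i≢j C≁i C≁j = bagObstruction⇒⊥ record
      { piece = piece ; i≢j = i≢j ; C-misses-i = C≁i ; C-misses-j = C≁j
      ; X-nonempty = bag-nonempty model k ; Y-nonempty = bag-nonempty model l
      ; X-connected = bag-connected model k ; Y-connected = bag-connected model l
      ; X∩Y = bags-disjoint k≢l ; C∩X = outside-disjoint lies-outside ; C∩Y = outside-disjoint lies-outside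
      ; X∩i = bags-disjoint k≢i ; X∩j = bags-disjoint k≢j ; Y∩i = bags-disjoint l≢i ; Y∩j = bags-disjoint l≢j
      ; X~Y = bags-touch model k≢l ; C~X = C~k ; C~Y = C~l
      ; X~i = bags-touch model k≢i ; X~j = bags-touch model k≢j ; Y~i = bags-touch model l≢i ; Y~j = bags-touch model l≢j
      }
      where
      open OutsidePiece piece
      distinct : ∀ {a b} → ¬ Touch C (bag ψ a) → Touch C (bag ψ b) → b ≢ a
      distinct C≁a C~b refl = C≁a C~b
      k≢i = distinct C≁i C~k
      k≢j = distinct C≁j C~k
      l≢i = distinct C≁i C~l
      l≢j = distinct C≁j C~l

    touches-all-but-one : ∀ {C} → OutsidePiece ψ C → ¬ AtMostOneBag ψ C → ¬ ¬ ∃ λ e → AllBut e (λ h → Touch C (bag ψ h))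
    touches-all-but-one piece ¬atMostOne goal = ¬atMostOne λ k≢l C~k C~l →
      ¬¬-allBut (touches-two⇒misses-at-most-one piece k≢l C~k C~l) goal

    new-vertex-touches : ∀ {C w e} → AllBut e (λ h → Touch (C ∪ ⁅ w ⁆) (bag ψ h)) →
                         ∀ {h} → h ≢ e → ¬ Touch C (bag ψ h) → Touch ⁅ w ⁆ (bag ψ h)
    new-vertex-touches allBut h≢e C≁h = ∪-touch⁻ (allBut _ h≢e) C≁h

    blocked-neighbour⇒⊥ : ∀ {C k w} → OutsidePiece ψ C → AtMostOneBag ψ C → Touch C (bag ψ k) →
                          OutsideNeighbour ψ C w → ¬ AtMostOneBag ψ (C ∪ ⁅ w ⁆) → ⊥
    blocked-neighbour⇒⊥ {C} {k} {w} piece atMostOne C~k w-nb@(ψw≡nothing , w∉C , C~w) blocked =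
      touches-all-but-one (extend piece w-nb) blocked λ (e , allBut) →
      let (i , j , m , (i≢j , i≢m , j≢m) , (i≢k , i≢e) , (j≢k , j≢e) , (m≢k , m≢e)) = three-others k e
          w~ : ∀ {h} → h ≢ k → h ≢ e → Touch ⁅ w ⁆ (bag ψ h)
          w~ h≢k h≢e = new-vertex-touches allBut h≢e (atMostOne (≢-sym h≢k) C~k)
      in bagObstruction⇒⊥ {X = ⁅ w ⁆} {Y = bag ψ k ∪ bag ψ m} record
        { piece = piece ; i≢j = i≢j
        ; C-misses-i = atMostOne (≢-sym i≢k) C~k ; C-misses-j = atMostOne (≢-sym j≢k) C~k
        ; X-nonempty = w , x∈⁅x⁆ w
        ; Y-nonempty = let (v , v∈k) = bag-nonempty model k in v , x∈p∪q⁺ (inj₁ v∈k)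
        ; X-connected = connected-⁅⁆ w
        ; Y-connected = connected-∪ (bag-connected model k) (bag-connected model m) (bags-touch model (≢-sym m≢k))
        ; X∩Y = disjoint-∪ʳ (disjoint-⁅⁆ (∉bag-of-outside ψw≡nothing)) (disjoint-⁅⁆ (∉bag-of-outside ψw≡nothing))
        ; C∩X = disjoint-sym (disjoint-⁅⁆ w∉C)
        ; C∩Y = disjoint-∪ʳ (outside-disjoint lies-outside) (outside-disjoint lies-outside)
        ; X∩i = disjoint-⁅⁆ (∉bag-of-outside ψw≡nothing) ; X∩j = disjoint-⁅⁆ (∉bag-of-outside ψw≡nothing)
        ; Y∩i = disjoint-∪ (bags-disjoint (≢-sym i≢k)) (bags-disjoint (≢-sym i≢m))
        ; Y∩j = disjoint-∪ (bags-disjoint (≢-sym j≢k)) (bags-disjoint (≢-sym j≢m))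
        ; X~Y = touch-∪ʳ (w~ m≢k m≢e) ; C~X = C~w ; C~Y = touch-∪ˡ C~k
        ; X~i = w~ i≢k i≢e ; X~j = w~ j≢k j≢e
        ; Y~i = ∪-touchˡ (bags-touch model (≢-sym i≢k)) ; Y~j = ∪-touchˡ (bags-touch model (≢-sym j≢k))
        }
      where open OutsidePiece piece

    neighbour-of-bagless-piece : ∀ {C w} → (∀ k → ¬ Touch C (bag ψ k)) → Touch C ⁅ w ⁆ → ψ w ≡ nothing
    neighbour-of-bagless-piece {w = w} C≁bags C~w with ψ w in ψw
    ... | nothing = refl
    ... | just h  = ⊥-elim (C≁bags h (touch-⁅⁆ C~w (∈bag⁺ ψw)))

    two-outside-neighbours : TwoConnected G → ∀ {C} → OutsidePiece ψ C → (∀ k → ¬ Touch C (bag ψ k)) →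
                             ∃₂ λ w z → w ≢ z × OutsideNeighbour ψ C w × OutsideNeighbour ψ C z
    two-outside-neighbours (_ , (_ , G-connected) , G-x-connected) {C} piece C≁bags =
      let (u , u∈bag) = bag-nonempty model i₀
          (v , v∈C) = nonempty
          u∉C = outside-∉C lies-outside (∈bag⁻ u∈bag)
          (w , w∉C , C~w , _) = walk-exit C (G-connected v u tt tt) v∈C u∉C
          ψw≡nothing = neighbour-of-bagless-piece C≁bags C~w
          v≢w : v ≢ w
          v≢w = λ v≡w → w∉C (subst (_∈ C) v≡w v∈C)
          u≢w : u ≢ w
          u≢w = λ u≡w → ∉bag-of-outside ψw≡nothing (subst (_∈ bag ψ i₀) u≡w u∈bag)
          (z , z∉C , C~z , z≢w) = walk-exit C (G-x-connected w v u v≢w u≢w) v∈C u∉C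
      in w , z , z≢w ∘ sym , (ψw≡nothing , w∉C , C~w) , (neighbour-of-bagless-piece C≁bags C~z , z∉C , C~z)
      where open OutsidePiece piece

    -- Each of the two outside neighbours w, z sees all bags but one; {w} and {z} ∪ B_m with two
    -- further bags i, j give the obstruction.
    saturated-piece-touches-a-bag : TwoConnected G → ∀ {C} → OutsidePiece ψ C → Saturated ψ C → ¬ (∀ k → ¬ Touch C (bag ψ k))
    saturated-piece-touches-a-bag 2-connected {C} piece saturated C≁bags
      with two-outside-neighbours 2-connected piece C≁bags
    ... | w , z , w≢z , w-nb@(ψw≡nothing , w∉C , C~w) , z-nb@(ψz≡nothing , z∉C , C~z) =
      touches-all-but-one (extend piece w-nb) (saturated w-nb) λ (e , allBut-w) →
      touches-all-but-one (extend piece z-nb) (saturated z-nb) λ (f , allBut-z) →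
      let (i , j , m , (i≢j , i≢m , j≢m) , (i≢e , i≢f) , (j≢e , j≢f) , (m≢e , m≢f)) = three-others e f
          w~ : ∀ {h} → h ≢ e → Touch ⁅ w ⁆ (bag ψ h)
          w~ h≢e = new-vertex-touches allBut-w h≢e (C≁bags _)
          z~ : ∀ {h} → h ≢ f → Touch ⁅ z ⁆ (bag ψ h)
          z~ h≢f = new-vertex-touches allBut-z h≢f (C≁bags _)
      in bagObstruction⇒⊥ {X = ⁅ w ⁆} {Y = ⁅ z ⁆ ∪ bag ψ m} record
        { piece = piece ; i≢j = i≢j ; C-misses-i = C≁bags i ; C-misses-j = C≁bags j
        ; X-nonempty = w , x∈⁅x⁆ w ; Y-nonempty = z , x∈p∪q⁺ (inj₁ (x∈⁅x⁆ z))
        ; X-connected = connected-⁅⁆ w ; Y-connected = connected-∪ (connected-⁅⁆ z) (bag-connected model m) (z~ m≢f)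
        ; X∩Y = disjoint-∪ʳ (disjoint-⁅⁆ (w≢z ∘ x∈⁅y⁆⇒x≡y z)) (disjoint-⁅⁆ (∉bag-of-outside ψw≡nothing))
        ; C∩X = disjoint-sym (disjoint-⁅⁆ w∉C)
        ; C∩Y = disjoint-∪ʳ (disjoint-sym (disjoint-⁅⁆ z∉C)) (outside-disjoint (OutsidePiece.lies-outside piece))
        ; X∩i = disjoint-⁅⁆ (∉bag-of-outside ψw≡nothing) ; X∩j = disjoint-⁅⁆ (∉bag-of-outside ψw≡nothing)
        ; Y∩i = disjoint-∪ (disjoint-⁅⁆ (∉bag-of-outside ψz≡nothing)) (bags-disjoint (≢-sym i≢m))
        ; Y∩j = disjoint-∪ (disjoint-⁅⁆ (∉bag-of-outside ψz≡nothing)) (bags-disjoint (≢-sym j≢m))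
        ; X~Y = touch-∪ʳ (w~ m≢e) ; C~X = C~w ; C~Y = touch-∪ˡ C~z
        ; X~i = w~ i≢e ; X~j = w~ j≢e
        ; Y~i = ∪-touchʳ (bags-touch model (≢-sym i≢m)) ; Y~j = ∪-touchʳ (bags-touch model (≢-sym j≢m))
        }

    other-bag-vertex : ∀ {C k x} → TwoConnected G → OutsidePiece ψ C → AtMostOneBag ψ C → Enclosed ψ C →
                       ψ x ≡ just k → Touch C ⁅ x ⁆ → ∃ λ z → x ≢ z × ψ z ≡ just k × Touch C ⁅ z ⁆
    other-bag-vertex {C} {k} {x} (_ , _ , G-x-connected) piece atMostOne enclosed ψx≡k C~x =
      let (i , _ , _ , (i≢k , _) , _) = two-others k k k
          (y , y∈i) = bag-nonempty model i
          (v , v∈C) = nonempty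
          v≢x : v ≢ x
          v≢x = λ v≡x → outside-∉C lies-outside ψx≡k (subst (_∈ C) v≡x v∈C)
          y≢x : y ≢ x
          y≢x = λ y≡x → ∉bag-of-other ψx≡k (≢-sym i≢k) (subst (_∈ bag ψ i) y≡x y∈i)
          (z , z∉C , C~z , z≢x) = walk-exit C (G-x-connected x v y v≢x y≢x) v∈C (outside-∉C lies-outside (∈bag⁻ y∈i))
      in z , ≢-sym z≢x , in-bag-k z∉C C~z , C~z
      where
      open OutsidePiece piece
      in-bag-k : ∀ {z} → z ∉ C → Touch C ⁅ z ⁆ → ψ z ≡ just k
      in-bag-k {z} z∉C C~z with ψ z in ψz
      ... | nothing = ⊥-elim (enclosed (ψz , z∉C , C~z))
      ... | just h with h ≟ k
      ...   | yes refl = refl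
      ...   | no h≢k   = ⊥-elim (atMostOne (≢-sym h≢k) (touch-⁅⁆ C~x (∈bag⁺ ψx≡k)) (touch-⁅⁆ C~z (∈bag⁺ ψz)))

    drop-private-vertex : ∀ {C k x z} → OutsidePiece ψ C → AtMostOneBag ψ C → ψ x ≡ just k → ψ z ≡ just k → x ≢ z →
                          (∀ h → h ≢ k → ¬ Touch ⁅ x ⁆ (bag ψ h)) → SmallerModel ψ C
    drop-private-vertex {C} {x = x} piece atMostOne ψx≡k ψz≡k x≢z x-private = record
      { labelling = without ψ x
      ; model     = without-isCompactKMinor model ψx≡k ψz≡k x≢z x-private
      ; piece     = record { lies-outside = λ v∈C → trans (without-≢ (v≢x v∈C)) (lies-outside v∈C)
                         ; connected = connected ; nonempty = nonempty }
      ; atMostOne = λ k≢l C~k C~l → atMostOne k≢l (touch-⊆ʳ bag-without-⊆ C~k) (touch-⊆ʳ bag-without-⊆ C~l)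
      ; smaller   = p⊂q⇒∣p∣<∣q∣ (support-without-⊂ (≡just⇒≢nothing {ψ} ψx≡k))
      }
      where
      open OutsidePiece piece
      v≢x : ∀ {v} → v ∈ C → v ≢ x
      v≢x v∈C v≡x = outside-∉C lies-outside ψx≡k (subst (_∈ C) v≡x v∈C)

    bag-pair-covers : ∀ {k x z} → ψ x ≡ just k → ψ z ≡ just k → x ≢ z →
                      ∀ {h} → h ≢ k → Touch ⁅ x ⁆ (bag ψ h) ⊎ Touch ⁅ z ⁆ (bag ψ h)
    bag-pair-covers {x = x} {z} ψx≡k ψz≡k x≢z h≢k with bags-touch model (≢-sym h≢k)
    ... | u , v , u∈k , v∈h , uv with bag-atMostTwo model ψx≡k ψz≡k (∈bag⁻ u∈k)
    ...   | inj₁ x≡z        = ⊥-elim (x≢z x≡z)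
    ...   | inj₂ (inj₁ refl) = inj₁ (x , v , x∈⁅x⁆ x , v∈h , uv)
    ...   | inj₂ (inj₂ refl) = inj₂ (z , v , x∈⁅x⁆ z , v∈h , uv)

    split-bag⇒⊥ : ∀ {C k x z p q} → OutsidePiece ψ C → AtMostOneBag ψ C → ψ x ≡ just k → ψ z ≡ just k → x ≢ z →
                  Touch C ⁅ x ⁆ → Touch C ⁅ z ⁆ → p ≢ q → p ≢ k → q ≢ k →
                  Touch ⁅ x ⁆ (bag ψ p) → Touch ⁅ z ⁆ (bag ψ q) → ⊥
    split-bag⇒⊥ {C} {k} {x} {z} {p} {q} piece atMostOne ψx≡k ψz≡k x≢z C~x C~z p≢q p≢k q≢k x~p z~q =
      let (i , j , i≢j , (i≢k , i≢p , i≢q) , (j≢k , j≢p , j≢q)) = two-others k p q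
          C~k = touch-⁅⁆ C~x (∈bag⁺ ψx≡k)
      in bagObstruction⇒⊥ {X = ⁅ x ⁆ ∪ bag ψ p} {Y = ⁅ z ⁆ ∪ bag ψ q} record
        { piece = piece ; i≢j = i≢j
        ; C-misses-i = atMostOne (≢-sym i≢k) C~k ; C-misses-j = atMostOne (≢-sym j≢k) C~k
        ; X-nonempty = x , x∈p∪q⁺ (inj₁ (x∈⁅x⁆ x)) ; Y-nonempty = z , x∈p∪q⁺ (inj₁ (x∈⁅x⁆ z))
        ; X-connected = connected-∪ (connected-⁅⁆ x) (bag-connected model p) x~p
        ; Y-connected = connected-∪ (connected-⁅⁆ z) (bag-connected model q) z~q
        ; X∩Y = disjoint-∪ (disjoint-∪ʳ (disjoint-⁅⁆ (x≢z ∘ x∈⁅y⁆⇒x≡y z)) (disjoint-⁅⁆ (∉bag-of-other ψx≡k (≢-sym q≢k))))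
                           (disjoint-∪ʳ (disjoint-sym (disjoint-⁅⁆ (∉bag-of-other ψz≡k (≢-sym p≢k)))) (bags-disjoint p≢q))
        ; C∩X = disjoint-∪ʳ (disjoint-sym (disjoint-⁅⁆ (outside-∉C lies-outside ψx≡k))) (outside-disjoint lies-outside)
        ; C∩Y = disjoint-∪ʳ (disjoint-sym (disjoint-⁅⁆ (outside-∉C lies-outside ψz≡k))) (outside-disjoint lies-outside)
        ; X∩i = disjoint-∪ (disjoint-⁅⁆ (∉bag-of-other ψx≡k (≢-sym i≢k))) (bags-disjoint (≢-sym i≢p))
        ; X∩j = disjoint-∪ (disjoint-⁅⁆ (∉bag-of-other ψx≡k (≢-sym j≢k))) (bags-disjoint (≢-sym j≢p))
        ; Y∩i = disjoint-∪ (disjoint-⁅⁆ (∉bag-of-other ψz≡k (≢-sym i≢k))) (bags-disjoint (≢-sym i≢q))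
        ; Y∩j = disjoint-∪ (disjoint-⁅⁆ (∉bag-of-other ψz≡k (≢-sym j≢k))) (bags-disjoint (≢-sym j≢q))
        ; X~Y = ∪-touchʳ (touch-∪ʳ (bags-touch model p≢q)) ; C~X = touch-∪ˡ C~x ; C~Y = touch-∪ˡ C~z
        ; X~i = ∪-touchʳ (bags-touch model (≢-sym i≢p)) ; X~j = ∪-touchʳ (bags-touch model (≢-sym j≢p))
        ; Y~i = ∪-touchʳ (bags-touch model (≢-sym i≢q)) ; Y~j = ∪-touchʳ (bags-touch model (≢-sym j≢q))
        }
      where open OutsidePiece piece

    shared-bag⇒⊥ : ∀ {C k x z p q} → OutsidePiece ψ C → AtMostOneBag ψ C → ψ x ≡ just k → ψ z ≡ just k → x ≢ z →
                   Touch C ⁅ x ⁆ → Touch C ⁅ z ⁆ → p ≢ k → q ≢ k →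
                   Touch ⁅ x ⁆ (bag ψ p) → Touch ⁅ z ⁆ (bag ψ q) → ⊥
    shared-bag⇒⊥ {k = k} {p = p} {q} piece atMostOne ψx≡k ψz≡k x≢z C~x C~z p≢k q≢k x~p z~q with p ≟ q
    ... | no p≢q = split-bag⇒⊥ piece atMostOne ψx≡k ψz≡k x≢z C~x C~z p≢q p≢k q≢k x~p z~q
    ... | yes refl with two-others k p p
    ...   | h , _ , _ , (h≢k , h≢p , _) , _ with bag-pair-covers ψx≡k ψz≡k x≢z h≢k
    ...     | inj₁ x~h = split-bag⇒⊥ piece atMostOne ψx≡k ψz≡k x≢z C~x C~z h≢p h≢k p≢k x~h z~q
    ...     | inj₂ z~h = split-bag⇒⊥ piece atMostOne ψx≡k ψz≡k x≢z C~x C~z (≢-sym h≢p) p≢k h≢k x~p z~h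

    -- If the second vertex of bag k touches no other bag it can be dropped from the model;
    -- otherwise the two vertices of bag k split it into two branch sets of an obstruction.
    enclosed-piece-shrinks : ∀ {C k} → TwoConnected G → OutsidePiece ψ C → AtMostOneBag ψ C → Enclosed ψ C →
                             Touch C (bag ψ k) → ¬ ¬ SmallerModel ψ C
    enclosed-piece-shrinks {C} {k} 2-connected piece atMostOne enclosed (u , x , u∈C , x∈k , ux) shrink =
      let ψx≡k = ∈bag⁻ x∈k
          C~x = u , x , u∈C , x∈⁅x⁆ x , ux
          (z , x≢z , ψz≡k , C~z) = other-bag-vertex 2-connected piece atMostOne enclosed ψx≡k C~x
      in ¬¬-excluded-middle {A = ∃ λ p → p ≢ k × Touch ⁅ x ⁆ (bag ψ p)} λ
        { (no x-private) → shrink (drop-private-vertex piece atMostOne ψx≡k ψz≡k x≢z λ h h≢k x~h → x-private (h , h≢k , x~h))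
        ; (yes (p , p≢k , x~p)) → ¬¬-excluded-middle {A = ∃ λ q → q ≢ k × Touch ⁅ z ⁆ (bag ψ q)} λ
          { (no z-private) → shrink (drop-private-vertex piece atMostOne ψz≡k ψx≡k (≢-sym x≢z) λ h h≢k z~h → z-private (h , h≢k , z~h))
          ; (yes (q , q≢k , z~q)) → shared-bag⇒⊥ piece atMostOne ψx≡k ψz≡k x≢z C~x C~z p≢k q≢k x~p z~q
          }
        }

  measure : Labelling → VertexSet → ℕ
  measure ψ C = ∣ support ψ ∣ + ∣ ∁ C ∣

  -- Induction on the size of the model and then on the number of vertices not in C.
  no-small-piece : TwoConnected G → ∀ {ψ C} → Acc _<_ (measure ψ C) → IsCompactKMinor G 5 ψ →
                   OutsidePiece ψ C → ¬ AtMostOneBag ψ C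
  no-small-piece 2-connected {ψ} {C} (acc rec) model piece atMostOne =
    ¬¬-excluded-middle {A = ∃ λ w → OutsideNeighbour ψ C w × AtMostOneBag ψ (C ∪ ⁅ w ⁆)} λ
      { (yes (w , w-nb@(_ , w∉C , _) , atMostOne′)) →
          no-small-piece 2-connected (rec (+-monoʳ-< ∣ support ψ ∣ (∣∁-∪⁅⁆∣< w∉C))) model (extend piece w-nb) atMostOne′
      ; (no ¬extendable) → ¬¬-excluded-middle {A = ∃ λ k → Touch C (bag ψ k)} λ
          { (no C≁bags) → saturated-piece-touches-a-bag model 2-connected piece (saturated ¬extendable) λ k C~k → C≁bags (k , C~k)
          ; (yes (k , C~k)) → ¬¬-excluded-middle {A = ∃ (OutsideNeighbour ψ C)} λ
              { (yes (w , w-nb)) → blocked-neighbour⇒⊥ model piece atMostOne C~k w-nb (saturated ¬extendable w-nb)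
              ; (no ∄w) → enclosed-piece-shrinks model 2-connected piece atMostOne (λ w-nb → ∄w (_ , w-nb)) C~k λ shrunk →
                  no-small-piece 2-connected (rec (+-monoˡ-< ∣ ∁ C ∣ (SmallerModel.smaller shrunk)))
                    (SmallerModel.model shrunk) (SmallerModel.piece shrunk) (SmallerModel.atMostOne shrunk)
              }
          }
      }
    where
    saturated : ¬ (∃ λ w → OutsideNeighbour ψ C w × AtMostOneBag ψ (C ∪ ⁅ w ⁆)) → Saturated ψ C
    saturated ¬extendable w-nb atMostOne′ = ¬extendable (_ , w-nb , atMostOne′)

  outside-vertex-misses-at-most-one : TwoConnected G → ∀ {ψ v} → IsCompactKMinor G 5 ψ → ψ v ≡ nothing →
                                      ∀ {i j} → i ≢ j → ¬ Touch ⁅ v ⁆ (bag ψ i) → ¬ Touch ⁅ v ⁆ (bag ψ j) → ⊥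
  outside-vertex-misses-at-most-one 2-connected {ψ} {v} model ψv≡nothing i≢j v≁i v≁j =
    ¬¬-excluded-middle {A = ∃₂ λ k l → k ≢ l × Touch ⁅ v ⁆ (bag ψ k) × Touch ⁅ v ⁆ (bag ψ l)} λ
      { (yes (k , l , k≢l , v~k , v~l)) → touches-two⇒misses-at-most-one model piece k≢l v~k v~l i≢j v≁i v≁j
      ; (no ∄kl) → no-small-piece 2-connected (<-wellFounded _) model piece λ k≢l v~k v~l → ∄kl (_ , _ , k≢l , v~k , v~l)
      }
    where
    piece : OutsidePiece ψ ⁅ v ⁆
    piece = record
      { lies-outside = λ u∈⁅v⁆ → subst (λ u → ψ u ≡ nothing) (sym (x∈⁅y⁆⇒x≡y v u∈⁅v⁆)) ψv≡nothing
      ; connected    = connected-⁅⁆ v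
      ; nonempty     = v , x∈⁅x⁆ v
      }

  -- Each of a, b, c misses at most one bag, so two bags k, l are seen by all three;
  -- then {c}, {a}, {b}, B_k, B_l model co-(P3 ∪ 2K1) with c as the vertex of degree 2.
  outside-K2∪K1-free : TwoConnected G → ∀ {ψ} → IsCompactKMinor G 5 ψ → K2∪K1-FreeOn G (λ v → ψ v ≡ nothing)
  outside-K2∪K1-free 2-connected {ψ} model a b c ψa≡nothing ψb≡nothing ψc≡nothing ab c≢a c≢b ¬ac ¬bc =
    ¬¬-allBut (outside-vertex-misses-at-most-one 2-connected model ψa≡nothing) λ (eᵃ , a~) →
    ¬¬-allBut (outside-vertex-misses-at-most-one 2-connected model ψb≡nothing) λ (eᵇ , b~) →
    ¬¬-allBut (outside-vertex-misses-at-most-one 2-connected model ψc≡nothing) λ (eᶜ , c~) →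
    let (k , l , k≢l , (k≢eᵃ , k≢eᵇ , k≢eᶜ) , (l≢eᵃ , l≢eᵇ , l≢eᶜ)) = two-others eᵃ eᵇ eᶜ
        S : Fin 5 → VertexSet
        S = λ { i₀ → ⁅ c ⁆ ; i₁ → ⁅ a ⁆ ; i₂ → ⁅ b ⁆ ; i₃ → bag ψ k ; i₄ → bag ψ l }
    in noMinor (coP3∪2K1-fromSets record
      { S          = S
      ; nonempty   = λ { i₀ → c , x∈⁅x⁆ c ; i₁ → a , x∈⁅x⁆ a ; i₂ → b , x∈⁅x⁆ b ; i₃ → bag-nonempty model k ; i₄ → bag-nonempty model l }
      ; connected  = λ { i₀ → connected-⁅⁆ c ; i₁ → connected-⁅⁆ a ; i₂ → connected-⁅⁆ b
                       ; i₃ → bag-connected model k ; i₄ → bag-connected model l }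
      ; disjoint₀₁ = disjoint-⁅⁆ (c≢a ∘ x∈⁅y⁆⇒x≡y a)
      ; disjoint₀₂ = disjoint-⁅⁆ (c≢b ∘ x∈⁅y⁆⇒x≡y b)
      ; disjoint₀₃ = disjoint-⁅⁆ (∉bag-of-outside ψc≡nothing)
      ; disjoint₀₄ = disjoint-⁅⁆ (∉bag-of-outside ψc≡nothing)
      ; disjoint₁₂ = disjoint-⁅⁆ λ a∈⁅b⁆ → irrAdj G (subst (Adj G a) (sym (x∈⁅y⁆⇒x≡y b a∈⁅b⁆)) ab)
      ; disjoint₁₃ = disjoint-⁅⁆ (∉bag-of-outside ψa≡nothing)
      ; disjoint₁₄ = disjoint-⁅⁆ (∉bag-of-outside ψa≡nothing)
      ; disjoint₂₃ = disjoint-⁅⁆ (∉bag-of-outside ψb≡nothing)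
      ; disjoint₂₄ = disjoint-⁅⁆ (∉bag-of-outside ψb≡nothing)
      ; disjoint₃₄ = bags-disjoint k≢l
      ; touch₀₃ = c~ k k≢eᶜ ; touch₀₄ = c~ l l≢eᶜ
      ; touch₁₂ = a , b , x∈⁅x⁆ a , x∈⁅x⁆ b , ab
      ; touch₁₃ = a~ k k≢eᵃ ; touch₁₄ = a~ l l≢eᵃ
      ; touch₂₃ = b~ k k≢eᵇ ; touch₂₄ = b~ l l≢eᵇ
      ; touch₃₄ = bags-touch model k≢l
      ; apart₀₁ = ¬ac ∘ symAdj G ∘ touch-⁅⁆⁅⁆⁻
      ; apart₀₂ = ¬bc ∘ symAdj G ∘ touch-⁅⁆⁅⁆⁻
      })

module Restriction (G : Graph) {s t : ℕ} (s≤t : s ≤ t) where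
  open VertexSets G

  embed : Fin s → Fin t
  embed h = inject≤ h s≤t

  restrict : Maybe (Fin t) → Maybe (Fin s)
  restrict nothing = nothing
  restrict (just h) with toℕ h <? s
  ... | yes h<s = just (fromℕ< h<s)
  ... | no _    = nothing

  restrict⁻ : ∀ {m h} → restrict m ≡ just h → m ≡ just (embed h)
  restrict⁻ {just h} e with toℕ h <? s
  restrict⁻ {just h} refl | yes h<s =
    cong just (toℕ-injective (trans (sym (toℕ-fromℕ< h<s)) (sym (toℕ-inject≤ (fromℕ< h<s) s≤t))))

  restrict⁺ : ∀ {m h} → m ≡ just (embed h) → restrict m ≡ just h
  restrict⁺ {h = h} refl with toℕ (embed h) <? s
  ... | yes h<s  = cong just (toℕ-injective (trans (toℕ-fromℕ< h<s) (toℕ-inject≤ h s≤t)))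
  ... | no ¬h<s = ⊥-elim (¬h<s (subst (_< s) (sym (toℕ-inject≤ h s≤t)) (toℕ<n h)))

  restrict-isCompactKMinor : ∀ {φ} → IsCompactKMinor G t φ → IsCompactKMinor G s (restrict ∘ φ)
  restrict-isCompactKMinor (bags , edges) =
      (λ h → let (nonempty , connected , atMostTwo) = bags (embed h) in
               (proj₁ nonempty , restrict⁺ (proj₂ nonempty))
             , (λ u v u↦h v↦h → walk-map restrict⁺ (connected u v (restrict⁻ u↦h) (restrict⁻ v↦h)))
             , (λ a b c a↦h b↦h c↦h → atMostTwo a b c (restrict⁻ a↦h) (restrict⁻ b↦h) (restrict⁻ c↦h)))
    , λ h h' h≢h' → let (u , v , u↦h , v↦h' , uv) = edges (embed h) (embed h') (h≢h' ∘ inject≤-injective s≤t s≤t h h')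
                    in u , v , restrict⁺ u↦h , restrict⁺ v↦h' , uv

mainTheorem16 : (t : ℕ) → 5 ≤ t → (G : Graph) → TwoConnected G →
    ¬ IsInducedMinor coP3∪2K1 G →
    (φ : Fin (size G) → Maybe (Fin t)) → IsCompactKMinor G t φ →
    K2∪K1-FreeOn G (λ v → φ v ≡ nothing)
mainTheorem16 t 5≤t G 2-connected noMinor φ compact a b c φa≡nothing φb≡nothing φc≡nothing =
  outside-K2∪K1-free 2-connected (restrict-isCompactKMinor compact) a b c
    (cong restrict φa≡nothing) (cong restrict φb≡nothing) (cong restrict φc≡nothing)
  where
  open SmallPieces G noMinor
  open Restriction G 5≤t
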